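{- For every $n\ge1$, $g_n^2+g_{n+1}g_{n-1}=1$ (as polynomials in $\lambda$).
   Context: Let $\mathcal{I}$ be the set of finite subsets $I\subset\mathbf{N}_0$ such that $i\equiv|[0,i)\cap I|\pmod 2$ for every $i\in I$, and for $n\ge0$ let $$f_n(\lambda,m_0,\dots,m_{n-1})=\sum_{\substack{0\le k\le n\\ k\equiv n\ (\mathrm{mod}\ 2)}}\Big(\sum_{\substack{I\in\mathcal{I},\ I\subseteq[0,n)\\ |I|=k}}\prod_{i\in I}m_i\Big)\lambda^k .$$ Define $g_n(\lambda)=f_n(\lambda,1,-1,\dots,(-1)^{n-1})$, i.e. $f_n$ evaluated at $m_i=(-1)^i$ for $0\le i\le n-1$. -}

module Defs where

open import Data.Bool using (Bool; true; false; _∧_; _∨_; not; if_then_else_)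
open import Data.Nat as ℕ using (ℕ; zero; suc; _%_)
import Data.Nat.Properties as ℕP
open import Data.Fin using (Fin; toℕ)
open import Data.Vec using (Vec; []; _∷_; lookup)
open import Data.List using (List; []; _∷_; map; _++_; filter; sum; upTo; allFin)
import Data.List as List
open import Data.Integer as ℤ using (ℤ; +_; -_)
open import Relation.Nullary.Decidable using (⌊_⌋)
open import Relation.Binary.PropositionalEquality using (_≡_)

-- A subset I ⊆ [0,n) is represented by its characteristic vector (Vec Bool n):
-- i ∈ I  iff  lookup I i ≡ true.

allSubsets : (n : ℕ) → List (Vec Bool n)
allSubsets zero    = [] ∷ []
allSubsets (suc n) = map (false ∷_) (allSubsets n) ++ map (true ∷_) (allSubsets n)

_∈ᵇ_ : {n : ℕ} → Fin n → Vec Bool n → Bool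
i ∈ᵇ I = lookup I i

card : {n : ℕ} → Vec Bool n → ℕ
card I = List.length (filter (λ i → i ∈ᵇ I Data.Bool.≟ true) (allFin _))

countBelow : {n : ℕ} → Vec Bool n → Fin n → ℕ
countBelow I i =
  List.length (filter (λ j → (toℕ j ℕ.<? toℕ i)) (filter (λ j → j ∈ᵇ I Data.Bool.≟ true) (allFin _)))

allᵇ : {A : Set} → (A → Bool) → List A → Bool
allᵇ p = List.foldr (λ x b → p x ∧ b) true

inCalI : {n : ℕ} → Vec Bool n → Bool
inCalI I = allᵇ (λ i → not (i ∈ᵇ I) ∨ ⌊ toℕ i % 2 ℕ.≟ countBelow I i % 2 ⌋) (allFin _)

prodOver : {n : ℕ} → (ℕ → ℤ) → Vec Bool n → ℤ
prodOver m I = List.foldr ℤ._*_ (+ 1)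
  (map (λ i → m (toℕ i)) (filter (λ i → i ∈ᵇ I Data.Bool.≟ true) (allFin _)))

-- Polynomials in λ with integer coefficients are represented by their
-- coefficient functions ℕ → ℤ (coefficient of λ^k at k).
Poly : Set
Poly = ℕ → ℤ

-- f_n(λ, m_0, …, m_{n-1}); only m_0,…,m_{n-1} are used.
f : (n : ℕ) → (ℕ → ℤ) → Poly
f n m k =
  if ⌊ k % 2 ℕ.≟ n % 2 ⌋
  then sum' (map (prodOver m)
         (filter (λ I → (inCalI I Data.Bool.≟ true)) (filter (λ I → card I ℕ.≟ k) (allSubsets n))))
  else + 0
  where
  sum' : List ℤ → ℤ
  sum' = List.foldr ℤ._+_ (+ 0)

altSign : ℕ → ℤ
altSign i = if ⌊ i % 2 ℕ.≟ 0 ⌋ then + 1 else - (+ 1)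

g : ℕ → Poly
g n = f n altSign

_⊕_ : Poly → Poly → Poly
(p ⊕ q) k = p k ℤ.+ q k

_⊗_ : Poly → Poly → Poly
(p ⊗ q) k = List.foldr ℤ._+_ (+ 0) (map (λ j → p j ℤ.* q (k ℕ.∸ j)) (upTo (suc k)))

one : Poly
one zero    = + 1
one (suc _) = + 0

-- Membership in 𝓘 can be decided by scanning the positions from the left, remembering only whether
-- the current position and the number of elements already taken have the same parity.  Removing
-- position 0 turns the weights m_i into m_(i+1); for m_i = (−1)^i this multiplies a term of degree k
-- by (−1)^k, i.e. substitutes −λ for λ.  So the sums h_n over all admissible I ⊆ [0,n), without the
-- restriction k ≡ n (mod 2), satisfy h_(n+2)(λ) = h_n(λ) + λ h_(n+1)(−λ), and keeping only the degrees
-- k ≡ n (mod 2) gives g_(n+2) = g_n + (−1)^(n+1) λ g_(n+1).  For a three-term recurrence with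
-- alternating signs, g_(n+1)² + g_(n+2) g_n does not depend on n (the cross terms ±λ g_(n+1) g_(n+2) of
-- consecutive forms coincide), and g_0 = 1, g_1 = λ give the value 1.

module Submission where

open import Defs
open import Data.Bool using (Bool; true; false; T; not; _∧_; _∨_; if_then_else_)
import Data.Bool as Bool
open import Data.Bool.Properties using (if-eta; not-involutive)
open import Data.Fin as Fin using (Fin; toℕ)
open import Data.Integer using (ℤ; +_; -_; _+_; _*_; _^_; 1ℤ; -1ℤ)
import Data.Integer.Properties as ℤP
open import Data.Integer.Tactic.RingSolver using (solve-∀)
open import Data.List using (List; []; _∷_; map; _++_; filter; allFin; upTo; applyUpTo; length)
import Data.List as List
import Data.List.Properties as ListP
import Data.List.Relation.Unary.All as All
open import Data.Nat as ℕ using (ℕ; zero; suc; _%_)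
open import Data.Nat.DivMod using ([m+n]%n≡m%n)
import Data.Nat.Properties as ℕP
open import Data.Product using (_,_)
open import Data.Vec using (Vec; []; _∷_)
open import Function using (id; _∘_)
open import Level using (0ℓ)
open import Relation.Binary.PropositionalEquality
import Relation.Binary.Reasoning.Setoid as SetoidReasoning
open import Relation.Nullary.Decidable using (Dec; ⌊_⌋; does; toWitness)
open import Relation.Unary using (Pred; Decidable)

module ≗-Reasoning = SetoidReasoning (ℕ →-setoid ℤ)

-- Polynomial arithmetic on coefficient functions

shift : Poly → Poly
shift p zero    = + 0
shift p (suc k) = p k

infixr 25 _·_

_·_ : ℤ → Poly → Poly
(c · p) k = c * p k

shift-cong : ∀ {p q} → p ≗ q → shift p ≗ shift q
shift-cong p≗q zero    = refl
shift-cong p≗q (suc k) = p≗q k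

·-cong : ∀ {c c′ p q} → c ≡ c′ → p ≗ q → c · p ≗ c′ · q
·-cong c≡c′ p≗q k = cong₂ _*_ c≡c′ (p≗q k)

·-congˡ : ∀ c {p q} → p ≗ q → c · p ≗ c · q
·-congˡ c = ·-cong {c} refl

⊕-cong : ∀ {p p′ q q′} → p ≗ p′ → q ≗ q′ → (p ⊕ q) ≗ (p′ ⊕ q′)
⊕-cong p≗p′ q≗q′ k = cong₂ _+_ (p≗p′ k) (q≗q′ k)

⊕-congˡ : ∀ p {q q′} → q ≗ q′ → (p ⊕ q) ≗ (p ⊕ q′)
⊕-congˡ p = ⊕-cong {p} (λ _ → refl)

⊕-congʳ : ∀ q {p p′} → p ≗ p′ → (p ⊕ q) ≗ (p′ ⊕ q)
⊕-congʳ q p≗p′ = ⊕-cong {q = q} p≗p′ (λ _ → refl)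

·-shift : ∀ c p → c · shift p ≗ shift (c · p)
·-shift c p zero    = ℤP.*-zeroʳ c
·-shift c p (suc k) = refl

⊗-suc : ∀ p q k → (p ⊗ q) (suc k) ≡ p 0 * q (suc k) + ((p ∘ suc) ⊗ q) k
⊗-suc p q k = cong (λ xs → p 0 * q (suc k) + List.foldr _+_ (+ 0) xs) (begin
    map term (applyUpTo suc (suc k))      ≡⟨ ListP.map-applyUpTo suc term (suc k) ⟩
    applyUpTo (term ∘ suc) (suc k)        ≡⟨ ListP.map-applyUpTo id (term ∘ suc) (suc k) ⟨
    map (term ∘ suc) (upTo (suc k))       ∎)
  where
  open ≡-Reasoning
  term : ℕ → ℤ
  term j = p j * q (suc k ℕ.∸ j)

⊗-cong : ∀ {p p′ q q′} → p ≗ p′ → q ≗ q′ → (p ⊗ q) ≗ (p′ ⊗ q′)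
⊗-cong p≗p′ q≗q′ zero    = cong (_+ + 0) (cong₂ _*_ (p≗p′ 0) (q≗q′ 0))
⊗-cong {p} {p′} {q} {q′} p≗p′ q≗q′ (suc k) = begin
  (p ⊗ q) (suc k)                          ≡⟨ ⊗-suc p q k ⟩
  p 0 * q (suc k) + ((p ∘ suc) ⊗ q) k      ≡⟨ cong₂ _+_ (cong₂ _*_ (p≗p′ 0) (q≗q′ (suc k)))
                                                         (⊗-cong (p≗p′ ∘ suc) q≗q′ k) ⟩
  p′ 0 * q′ (suc k) + ((p′ ∘ suc) ⊗ q′) k  ≡⟨ ⊗-suc p′ q′ k ⟨
  (p′ ⊗ q′) (suc k)                        ∎
  where open ≡-Reasoning

⊗-congˡ : ∀ p {q q′} → q ≗ q′ → (p ⊗ q) ≗ (p ⊗ q′)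
⊗-congˡ p = ⊗-cong {p} (λ _ → refl)

⊗-congʳ : ∀ q {p p′} → p ≗ p′ → (p ⊗ q) ≗ (p′ ⊗ q)
⊗-congʳ q p≗p′ = ⊗-cong {q = q} p≗p′ (λ _ → refl)

⊗-identityʳ : ∀ p → (p ⊗ one) ≗ p
⊗-identityʳ p zero    = trans (ℤP.+-identityʳ _) (ℤP.*-identityʳ (p 0))
⊗-identityʳ p (suc k) = begin
  (p ⊗ one) (suc k)                        ≡⟨ ⊗-suc p one k ⟩
  p 0 * + 0 + ((p ∘ suc) ⊗ one) k          ≡⟨ cong₂ _+_ (ℤP.*-zeroʳ (p 0)) (⊗-identityʳ (p ∘ suc) k) ⟩
  + 0 + p (suc k)                          ≡⟨ ℤP.+-identityˡ _ ⟩
  p (suc k)                                ∎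
  where open ≡-Reasoning

⊗-shiftˡ : ∀ p q → (shift p ⊗ q) ≗ shift (p ⊗ q)
⊗-shiftˡ p q zero    = refl
⊗-shiftˡ p q (suc k) = trans (⊗-suc (shift p) q k) (ℤP.+-identityˡ _)

⊗-shiftʳ : ∀ p q → (p ⊗ shift q) ≗ shift (p ⊗ q)
⊗-shiftʳ p q zero          = cong (_+ + 0) (ℤP.*-zeroʳ (p 0))
⊗-shiftʳ p q (suc zero)    = cong (_+_ (p 0 * q 0)) (⊗-shiftʳ (p ∘ suc) q zero)
⊗-shiftʳ p q (suc (suc k)) = begin
  (p ⊗ shift q) (suc (suc k))                  ≡⟨ ⊗-suc p (shift q) (suc k) ⟩
  p 0 * q (suc k) + ((p ∘ suc) ⊗ shift q) (suc k) ≡⟨ cong (_+_ (p 0 * q (suc k))) (⊗-shiftʳ (p ∘ suc) q (suc k)) ⟩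
  p 0 * q (suc k) + ((p ∘ suc) ⊗ q) k          ≡⟨ ⊗-suc p q k ⟨
  (p ⊗ q) (suc k)                              ∎
  where open ≡-Reasoning

⊗-scaleˡ : ∀ c p q → ((c · p) ⊗ q) ≗ c · (p ⊗ q)
⊗-scaleˡ c p q zero    = factor c (p 0) (q 0)
  where
  factor : ∀ c a b → c * a * b + + 0 ≡ c * (a * b + + 0)
  factor = solve-∀
⊗-scaleˡ c p q (suc k) = begin
  ((c · p) ⊗ q) (suc k)                  ≡⟨ ⊗-suc (c · p) q k ⟩
  c * p 0 * q (suc k) + ((c · (p ∘ suc)) ⊗ q) k ≡⟨ cong (_+_ (c * p 0 * q (suc k))) (⊗-scaleˡ c (p ∘ suc) q k) ⟩
  c * p 0 * q (suc k) + c * ((p ∘ suc) ⊗ q) k   ≡⟨ factor c (p 0) (q (suc k)) _ ⟩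
  c * (p 0 * q (suc k) + ((p ∘ suc) ⊗ q) k)     ≡⟨ cong (c *_) (⊗-suc p q k) ⟨
  c * (p ⊗ q) (suc k)                    ∎
  where
  open ≡-Reasoning
  factor : ∀ c a b r → c * a * b + c * r ≡ c * (a * b + r)
  factor = solve-∀

⊗-scaleʳ : ∀ c p q → (p ⊗ (c · q)) ≗ c · (p ⊗ q)
⊗-scaleʳ c p q zero    = factor c (p 0) (q 0)
  where
  factor : ∀ c a b → a * (c * b) + + 0 ≡ c * (a * b + + 0)
  factor = solve-∀
⊗-scaleʳ c p q (suc k) = begin
  (p ⊗ (c · q)) (suc k)                  ≡⟨ ⊗-suc p (c · q) k ⟩
  p 0 * (c * q (suc k)) + ((p ∘ suc) ⊗ (c · q)) k ≡⟨ cong (_+_ (p 0 * (c * q (suc k)))) (⊗-scaleʳ c (p ∘ suc) q k) ⟩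
  p 0 * (c * q (suc k)) + c * ((p ∘ suc) ⊗ q) k   ≡⟨ factor c (p 0) (q (suc k)) _ ⟩
  c * (p 0 * q (suc k) + ((p ∘ suc) ⊗ q) k)       ≡⟨ cong (c *_) (⊗-suc p q k) ⟨
  c * (p ⊗ q) (suc k)                    ∎
  where
  open ≡-Reasoning
  factor : ∀ c a b r → a * (c * b) + c * r ≡ c * (a * b + r)
  factor = solve-∀

⊗-distribʳ-⊕ : ∀ r p q → ((p ⊕ q) ⊗ r) ≗ ((p ⊗ r) ⊕ (q ⊗ r))
⊗-distribʳ-⊕ r p q zero    = distrib (p 0) (q 0) (r 0)
  where
  distrib : ∀ a b c → (a + b) * c + + 0 ≡ (a * c + + 0) + (b * c + + 0)
  distrib = solve-∀
⊗-distribʳ-⊕ r p q (suc k) = begin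
  ((p ⊕ q) ⊗ r) (suc k)                                        ≡⟨ ⊗-suc (p ⊕ q) r k ⟩
  (p 0 + q 0) * r (suc k) + (((p ∘ suc) ⊕ (q ∘ suc)) ⊗ r) k    ≡⟨ cong (_+_ ((p 0 + q 0) * r (suc k)))
                                                                      (⊗-distribʳ-⊕ r (p ∘ suc) (q ∘ suc) k) ⟩
  (p 0 + q 0) * r (suc k) + (((p ∘ suc) ⊗ r) k + ((q ∘ suc) ⊗ r) k)
                                                              ≡⟨ distrib (p 0) (q 0) (r (suc k)) _ _ ⟩
  (p 0 * r (suc k) + ((p ∘ suc) ⊗ r) k) + (q 0 * r (suc k) + ((q ∘ suc) ⊗ r) k)
                                                              ≡⟨ cong₂ _+_ (⊗-suc p r k) (⊗-suc q r k) ⟨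
  (p ⊗ r) (suc k) + (q ⊗ r) (suc k)                            ∎
  where
  open ≡-Reasoning
  distrib : ∀ a b c x y → (a + b) * c + (x + y) ≡ (a * c + x) + (b * c + y)
  distrib = solve-∀

⊗-distribˡ-⊕ : ∀ p q r → (p ⊗ (q ⊕ r)) ≗ ((p ⊗ q) ⊕ (p ⊗ r))
⊗-distribˡ-⊕ p q r zero    = distrib (p 0) (q 0) (r 0)
  where
  distrib : ∀ a b c → a * (b + c) + + 0 ≡ (a * b + + 0) + (a * c + + 0)
  distrib = solve-∀
⊗-distribˡ-⊕ p q r (suc k) = begin
  (p ⊗ (q ⊕ r)) (suc k)                                        ≡⟨ ⊗-suc p (q ⊕ r) k ⟩
  p 0 * (q (suc k) + r (suc k)) + ((p ∘ suc) ⊗ (q ⊕ r)) k      ≡⟨ cong (_+_ (p 0 * (q (suc k) + r (suc k))))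
                                                                      (⊗-distribˡ-⊕ (p ∘ suc) q r k) ⟩
  p 0 * (q (suc k) + r (suc k)) + (((p ∘ suc) ⊗ q) k + ((p ∘ suc) ⊗ r) k)
                                                              ≡⟨ distrib (p 0) (q (suc k)) (r (suc k)) _ _ ⟩
  (p 0 * q (suc k) + ((p ∘ suc) ⊗ q) k) + (p 0 * r (suc k) + ((p ∘ suc) ⊗ r) k)
                                                              ≡⟨ cong₂ _+_ (⊗-suc p q k) (⊗-suc p r k) ⟨
  (p ⊗ q) (suc k) + (p ⊗ r) (suc k)                            ∎
  where
  open ≡-Reasoning
  distrib : ∀ a b c x y → a * (b + c) + (x + y) ≡ (a * b + x) + (a * c + y)
  distrib = solve-∀

-- Cassini's identity for three-term recurrences

cassiniForm : (ℕ → Poly) → ℕ → Poly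
cassiniForm p n = (p (suc n) ⊗ p (suc n)) ⊕ (p (suc (suc n)) ⊗ p n)

module ThreeTermRecurrence
  (p : ℕ → Poly) (ε : ℕ → ℤ) (ε-suc : ∀ n → ε (suc n) ≡ - ε n)
  (p-rec : ∀ n → p (suc (suc n)) ≗ (p n ⊕ ε n · shift (p (suc n))))
  where

  open ≗-Reasoning

  cassiniForm-suc : ∀ n → cassiniForm p (suc n) ≗ cassiniForm p n
  cassiniForm-suc n = begin
    (c ⊗ c) ⊕ (d ⊗ b)                  ≈⟨ ⊕-congˡ (c ⊗ c) d⊗b ⟩
    (c ⊗ c) ⊕ ((b ⊗ b) ⊕ cross)        ≈⟨ (λ k → leftComm ((c ⊗ c) k) ((b ⊗ b) k) (cross k)) ⟩
    (b ⊗ b) ⊕ ((c ⊗ c) ⊕ cross)        ≈⟨ ⊕-congˡ (b ⊗ b) c⊗a ⟨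
    (b ⊗ b) ⊕ (c ⊗ a)                  ∎
    where
    a = p n
    b = p (suc n)
    c = p (suc (suc n))
    d = p (suc (suc (suc n)))
    e = ε (suc n)
    cross = e · shift (c ⊗ b)

    leftComm : ∀ x y z → x + (y + z) ≡ y + (x + z)
    leftComm = solve-∀

    backwards : ∀ x s t → x ≡ (x + s * t) + (- s) * t
    backwards = solve-∀

    a-rec : a ≗ (c ⊕ e · shift b)
    a-rec k = trans (backwards (a k) (ε n) (shift b k))
                    (cong₂ (λ x s → x + s * shift b k) (sym (p-rec n k)) (sym (ε-suc n)))

    c⊗a : (c ⊗ a) ≗ ((c ⊗ c) ⊕ cross)
    c⊗a = begin
      c ⊗ a                            ≈⟨ ⊗-congˡ c a-rec ⟩
      c ⊗ (c ⊕ e · shift b)            ≈⟨ ⊗-distribˡ-⊕ c c (e · shift b) ⟩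
      (c ⊗ c) ⊕ (c ⊗ (e · shift b))    ≈⟨ ⊕-congˡ (c ⊗ c) (⊗-scaleʳ e c (shift b)) ⟩
      (c ⊗ c) ⊕ e · (c ⊗ shift b)      ≈⟨ ⊕-congˡ (c ⊗ c) (·-congˡ e (⊗-shiftʳ c b)) ⟩
      (c ⊗ c) ⊕ cross                  ∎

    d⊗b : (d ⊗ b) ≗ ((b ⊗ b) ⊕ cross)
    d⊗b = begin
      d ⊗ b                            ≈⟨ ⊗-congʳ b (p-rec (suc n)) ⟩
      (b ⊕ e · shift c) ⊗ b            ≈⟨ ⊗-distribʳ-⊕ b b (e · shift c) ⟩
      (b ⊗ b) ⊕ ((e · shift c) ⊗ b)    ≈⟨ ⊕-congˡ (b ⊗ b) (⊗-scaleˡ e (shift c) b) ⟩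
      (b ⊗ b) ⊕ e · (shift c ⊗ b)      ≈⟨ ⊕-congˡ (b ⊗ b) (·-congˡ e (⊗-shiftˡ c b)) ⟩
      (b ⊗ b) ⊕ cross                  ∎

  cassini : ε 0 ≡ -1ℤ → p 0 ≗ one → p 1 ≗ shift one → ∀ n → cassiniForm p n ≗ one
  cassini ε₀ p₀ p₁ zero = begin
    (p 1 ⊗ p 1) ⊕ (p 2 ⊗ p 0)            ≈⟨ ⊕-cong p₁⊗p₁ p₂⊗p₀ ⟩
    λ² ⊕ (one ⊕ -1ℤ · λ²)                ≈⟨ (λ k → cancel (λ² k) (one k)) ⟩
    one                                  ∎
    where
    λ² = shift (shift one)

    cancel : ∀ x y → x + (y + -1ℤ * x) ≡ y
    cancel = solve-∀

    p₁⊗p₁ : (p 1 ⊗ p 1) ≗ λ²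
    p₁⊗p₁ = begin
      p 1 ⊗ p 1                          ≈⟨ ⊗-cong p₁ p₁ ⟩
      shift one ⊗ shift one              ≈⟨ ⊗-shiftˡ one (shift one) ⟩
      shift (one ⊗ shift one)            ≈⟨ shift-cong (⊗-shiftʳ one one) ⟩
      shift (shift (one ⊗ one))          ≈⟨ shift-cong (shift-cong (⊗-identityʳ one)) ⟩
      λ²                                 ∎

    p₂⊗p₀ : (p 2 ⊗ p 0) ≗ (one ⊕ -1ℤ · λ²)
    p₂⊗p₀ = begin
      p 2 ⊗ p 0                          ≈⟨ ⊗-cong (p-rec 0) p₀ ⟩
      (p 0 ⊕ ε 0 · shift (p 1)) ⊗ one    ≈⟨ ⊗-congʳ one (⊕-cong p₀ (·-cong ε₀ (shift-cong p₁))) ⟩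
      (one ⊕ -1ℤ · λ²) ⊗ one             ≈⟨ ⊗-identityʳ (one ⊕ -1ℤ · λ²) ⟩
      one ⊕ -1ℤ · λ²                     ∎
  cassini ε₀ p₀ p₁ (suc n) k = trans (cassiniForm-suc n k) (cassini ε₀ p₀ p₁ n k)

ss%2 : ∀ x → suc (suc x) % 2 ≡ x % 2
ss%2 x = trans (cong (_% 2) (ℕP.+-comm 2 x)) ([m+n]%n≡m%n x 2)

_≡₂ᵇ_ : ℕ → ℕ → Bool
a ≡₂ᵇ c = ⌊ a % 2 ℕ.≟ c % 2 ⌋

≡₂ᵇ-ssˡ : ∀ a c → (suc (suc a) ≡₂ᵇ c) ≡ (a ≡₂ᵇ c)
≡₂ᵇ-ssˡ a c = cong (λ r → ⌊ r ℕ.≟ c % 2 ⌋) (ss%2 a)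

≡₂ᵇ-ssʳ : ∀ a c → (a ≡₂ᵇ suc (suc c)) ≡ (a ≡₂ᵇ c)
≡₂ᵇ-ssʳ a c = cong (λ r → ⌊ a % 2 ℕ.≟ r ⌋) (ss%2 c)

≡₂ᵇ-sucˡ : ∀ a c → (suc a ≡₂ᵇ c) ≡ not (a ≡₂ᵇ c)
≡₂ᵇ-sucˡ zero          zero          = refl
≡₂ᵇ-sucˡ zero          (suc zero)    = refl
≡₂ᵇ-sucˡ (suc zero)    zero          = refl
≡₂ᵇ-sucˡ (suc zero)    (suc zero)    = refl
≡₂ᵇ-sucˡ (suc (suc a)) c             =
  trans (≡₂ᵇ-ssˡ (suc a) c) (trans (≡₂ᵇ-sucˡ a c) (cong not (sym (≡₂ᵇ-ssˡ a c))))
≡₂ᵇ-sucˡ a             (suc (suc c)) =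
  trans (≡₂ᵇ-ssʳ (suc a) c) (trans (≡₂ᵇ-sucˡ a c) (cong not (sym (≡₂ᵇ-ssʳ a c))))

≡₂ᵇ-sucʳ : ∀ a c → (a ≡₂ᵇ suc c) ≡ not (a ≡₂ᵇ c)
≡₂ᵇ-sucʳ zero          zero          = refl
≡₂ᵇ-sucʳ zero          (suc zero)    = refl
≡₂ᵇ-sucʳ (suc zero)    zero          = refl
≡₂ᵇ-sucʳ (suc zero)    (suc zero)    = refl
≡₂ᵇ-sucʳ (suc (suc a)) c             =
  trans (≡₂ᵇ-ssˡ a (suc c)) (trans (≡₂ᵇ-sucʳ a c) (cong not (sym (≡₂ᵇ-ssˡ a c))))
≡₂ᵇ-sucʳ a             (suc (suc c)) =
  trans (≡₂ᵇ-ssʳ a (suc c)) (trans (≡₂ᵇ-sucʳ a c) (cong not (sym (≡₂ᵇ-ssʳ a c))))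

≡₂ᵇ-suc : ∀ a c → (suc a ≡₂ᵇ suc c) ≡ (a ≡₂ᵇ c)
≡₂ᵇ-suc a c = trans (≡₂ᵇ-sucˡ a (suc c)) (trans (cong not (≡₂ᵇ-sucʳ a c)) (not-involutive (a ≡₂ᵇ c)))

altSign-suc : ∀ i → altSign (suc i) ≡ - altSign i
altSign-suc i = trans (cong sign (≡₂ᵇ-sucˡ i 0)) (sign-not (i ≡₂ᵇ 0))
  where
  sign : Bool → ℤ
  sign b = if b then + 1 else -1ℤ
  sign-not : ∀ b → sign (not b) ≡ - sign b
  sign-not false = refl
  sign-not true  = refl

≡₂ᵇ⇒altSign≡ : ∀ k n → T (k ≡₂ᵇ n) → altSign k ≡ altSign n
≡₂ᵇ⇒altSign≡ k n k≡₂n = cong (λ r → if ⌊ r ℕ.≟ 0 ⌋ then + 1 else -1ℤ) (toWitness k≡₂n)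

altSign-square : ∀ i → altSign i * altSign i ≡ 1ℤ
altSign-square i = sign² (i ≡₂ᵇ 0)
  where
  sign² : ∀ b → (if b then + 1 else -1ℤ) * (if b then + 1 else -1ℤ) ≡ 1ℤ
  sign² false = refl
  sign² true  = refl

-1^≡altSign : ∀ k → -1ℤ ^ k ≡ altSign k
-1^≡altSign zero    = refl
-1^≡altSign (suc k) = begin
  -1ℤ * -1ℤ ^ k    ≡⟨ cong (-1ℤ *_) (-1^≡altSign k) ⟩
  -1ℤ * altSign k  ≡⟨ ℤP.-1*i≡-i (altSign k) ⟩
  - altSign k      ≡⟨ altSign-suc k ⟨
  altSign (suc k)  ∎
  where open ≡-Reasoning

-- Subsets read from their first position

filter-map : ∀ {A B : Set} {P : Pred B 0ℓ} (P? : Decidable P) (f : A → B) xs →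
             filter P? (map f xs) ≡ map f (filter (P? ∘ f) xs)
filter-map P? f []       = refl
filter-map P? f (x ∷ xs) with does (P? (f x))
... | false = filter-map P? f xs
... | true  = cong (f x ∷_) (filter-map P? f xs)

allFin-suc : ∀ n → allFin (suc n) ≡ Fin.zero ∷ map Fin.suc (allFin n)
allFin-suc n = cong (Fin.zero ∷_) (sym (ListP.map-tabulate id Fin.suc))

isMember : ∀ {n} (I : Vec Bool n) (i : Fin n) → Dec (i ∈ᵇ I ≡ true)
isMember I i = i ∈ᵇ I Bool.≟ true

members : ∀ {n} → Vec Bool n → List (Fin n)
members I = filter (isMember I) (allFin _)

members-false∷ : ∀ {n} (I : Vec Bool n) → members (false ∷ I) ≡ map Fin.suc (members I)
members-false∷ {n} I = trans (cong (filter (isMember (false ∷ I))) (allFin-suc n)) (filter-map (isMember (false ∷ I)) Fin.suc (allFin n))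

members-true∷ : ∀ {n} (I : Vec Bool n) → members (true ∷ I) ≡ Fin.zero ∷ map Fin.suc (members I)
members-true∷ {n} I = trans (cong (filter (isMember (true ∷ I))) (allFin-suc n))
                            (cong (Fin.zero ∷_) (filter-map (isMember (true ∷ I)) Fin.suc (allFin n)))

card-false∷ : ∀ {n} (I : Vec Bool n) → card (false ∷ I) ≡ card I
card-false∷ I = trans (cong length (members-false∷ I)) (ListP.length-map Fin.suc (members I))

card-true∷ : ∀ {n} (I : Vec Bool n) → card (true ∷ I) ≡ suc (card I)
card-true∷ I = trans (cong length (members-true∷ I)) (cong suc (ListP.length-map Fin.suc (members I)))

prodOver-false∷ : ∀ {n} m (I : Vec Bool n) → prodOver m (false ∷ I) ≡ prodOver (m ∘ suc) I
prodOver-false∷ m I = cong (List.foldr _*_ 1ℤ)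
  (trans (cong (map (m ∘ toℕ)) (members-false∷ I)) (sym (ListP.map-∘ (members I))))

prodOver-true∷ : ∀ {n} m (I : Vec Bool n) → prodOver m (true ∷ I) ≡ m 0 * prodOver (m ∘ suc) I
prodOver-true∷ m I = cong (List.foldr _*_ 1ℤ)
  (trans (cong (map (m ∘ toℕ)) (members-true∷ I)) (cong (m 0 ∷_) (sym (ListP.map-∘ (members I)))))

prodOver-cong : ∀ {n m m′} → m ≗ m′ → (I : Vec Bool n) → prodOver m I ≡ prodOver m′ I
prodOver-cong m≗m′ I = cong (List.foldr _*_ 1ℤ) (ListP.map-cong (m≗m′ ∘ toℕ) (members I))

countBelow-zero : ∀ {n} b (I : Vec Bool n) → countBelow (b ∷ I) Fin.zero ≡ 0
countBelow-zero b I = cong length (ListP.filter-none _ (All.universal (λ _ ()) (members (b ∷ I))))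

below : ∀ {n} (i j : Fin n) → Dec (toℕ j ℕ.< toℕ i)
below i j = toℕ j ℕ.<? toℕ i

length-filter-below-suc : ∀ {n} (i : Fin n) xs →
  length (filter (below (Fin.suc i)) (map Fin.suc xs)) ≡ length (filter (below i) xs)
length-filter-below-suc i xs = begin
  length (filter (below (Fin.suc i)) (map Fin.suc xs))     ≡⟨ cong length (filter-map (below (Fin.suc i)) Fin.suc xs) ⟩
  length (map Fin.suc (filter (below (Fin.suc i) ∘ Fin.suc) xs)) ≡⟨ ListP.length-map Fin.suc (filter (below (Fin.suc i) ∘ Fin.suc) xs) ⟩
  length (filter (below (Fin.suc i) ∘ Fin.suc) xs)         ≡⟨ cong length (ListP.filter-≐ _ (below i) (ℕ.s<s⁻¹ , ℕ.s<s) xs) ⟩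
  length (filter (below i) xs)                             ∎
  where open ≡-Reasoning

countBelow-false∷ : ∀ {n} (I : Vec Bool n) i → countBelow (false ∷ I) (Fin.suc i) ≡ countBelow I i
countBelow-false∷ I i = trans (cong (length ∘ filter (below (Fin.suc i))) (members-false∷ I))
                              (length-filter-below-suc i (members I))

countBelow-true∷ : ∀ {n} (I : Vec Bool n) i → countBelow (true ∷ I) (Fin.suc i) ≡ suc (countBelow I i)
countBelow-true∷ I i = trans (cong (length ∘ filter (below (Fin.suc i))) (members-true∷ I))
                             (cong suc (length-filter-below-suc i (members I)))

-- The flag records whether the current position has the same parity as the number of
-- elements chosen before it; an element may only be chosen when it does.
admissible : ∀ {n} → Bool → Vec Bool n → Bool
admissible s []          = true
admissible s (false ∷ I) = admissible (not s) I
admissible s (true ∷ I)  = s ∧ admissible s I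

allᵇ-map : ∀ {A B : Set} (p : B → Bool) (f : A → B) xs → allᵇ p (map f xs) ≡ allᵇ (p ∘ f) xs
allᵇ-map p f []       = refl
allᵇ-map p f (x ∷ xs) = cong (p (f x) ∧_) (allᵇ-map p f xs)

allᵇ-cong : ∀ {A : Set} {p q : A → Bool} → p ≗ q → allᵇ p ≗ allᵇ q
allᵇ-cong p≗q []       = refl
allᵇ-cong p≗q (x ∷ xs) = cong₂ _∧_ (p≗q x) (allᵇ-cong p≗q xs)

allᵇ-allFin-suc : ∀ {n} (p : Fin (suc n) → Bool) → allᵇ p (allFin (suc n)) ≡ p Fin.zero ∧ allᵇ (p ∘ Fin.suc) (allFin n)
allᵇ-allFin-suc {n} p = trans (cong (allᵇ p) (allFin-suc n)) (cong (p Fin.zero ∧_) (allᵇ-map p Fin.suc (allFin n)))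

-- The condition defining 𝓘, for I placed at position a after c elements have already been taken.
inCalIConditionFrom : ∀ {n} → ℕ → ℕ → Vec Bool n → Fin n → Bool
inCalIConditionFrom a c I i = not (i ∈ᵇ I) ∨ ((a ℕ.+ toℕ i) ≡₂ᵇ (c ℕ.+ countBelow I i))

inCalIFrom : ∀ {n} → ℕ → ℕ → Vec Bool n → Bool
inCalIFrom a c I = allᵇ (inCalIConditionFrom a c I) (allFin _)

inCalIFrom-false∷ : ∀ {n} a c (I : Vec Bool n) → inCalIFrom a c (false ∷ I) ≡ inCalIFrom (suc a) c I
inCalIFrom-false∷ a c I = trans (allᵇ-allFin-suc (inCalIConditionFrom a c (false ∷ I))) (allᵇ-cong tail (allFin _))
  where
  tail : ∀ i → inCalIConditionFrom a c (false ∷ I) (Fin.suc i) ≡ inCalIConditionFrom (suc a) c I i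
  tail i = cong₂ (λ x y → not (i ∈ᵇ I) ∨ (x ≡₂ᵇ y)) (ℕP.+-suc a (toℕ i)) (cong (c ℕ.+_) (countBelow-false∷ I i))

inCalIFrom-true∷ : ∀ {n} a c (I : Vec Bool n) → inCalIFrom a c (true ∷ I) ≡ (a ≡₂ᵇ c) ∧ inCalIFrom (suc a) (suc c) I
inCalIFrom-true∷ a c I = trans (allᵇ-allFin-suc (inCalIConditionFrom a c (true ∷ I))) (cong₂ _∧_ head (allᵇ-cong tail (allFin _)))
  where
  head : inCalIConditionFrom a c (true ∷ I) Fin.zero ≡ (a ≡₂ᵇ c)
  head = cong₂ _≡₂ᵇ_ (ℕP.+-identityʳ a) (trans (cong (c ℕ.+_) (countBelow-zero true I)) (ℕP.+-identityʳ c))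
  tail : ∀ i → inCalIConditionFrom a c (true ∷ I) (Fin.suc i) ≡ inCalIConditionFrom (suc a) (suc c) I i
  tail i = cong₂ (λ x y → not (i ∈ᵇ I) ∨ (x ≡₂ᵇ y)) (ℕP.+-suc a (toℕ i))
                 (trans (cong (c ℕ.+_) (countBelow-true∷ I i)) (ℕP.+-suc c (countBelow I i)))

inCalIFrom≡admissible : ∀ {n} a c (I : Vec Bool n) → inCalIFrom a c I ≡ admissible (a ≡₂ᵇ c) I
inCalIFrom≡admissible a c []          = refl
inCalIFrom≡admissible a c (false ∷ I) = begin
  inCalIFrom a c (false ∷ I)        ≡⟨ inCalIFrom-false∷ a c I ⟩
  inCalIFrom (suc a) c I            ≡⟨ inCalIFrom≡admissible (suc a) c I ⟩
  admissible (suc a ≡₂ᵇ c) I        ≡⟨ cong (λ s → admissible s I) (≡₂ᵇ-sucˡ a c) ⟩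
  admissible (not (a ≡₂ᵇ c)) I      ∎
  where open ≡-Reasoning
inCalIFrom≡admissible a c (true ∷ I)  = begin
  inCalIFrom a c (true ∷ I)                     ≡⟨ inCalIFrom-true∷ a c I ⟩
  (a ≡₂ᵇ c) ∧ inCalIFrom (suc a) (suc c) I      ≡⟨ cong ((a ≡₂ᵇ c) ∧_) (inCalIFrom≡admissible (suc a) (suc c) I) ⟩
  (a ≡₂ᵇ c) ∧ admissible (suc a ≡₂ᵇ suc c) I    ≡⟨ cong (λ s → (a ≡₂ᵇ c) ∧ admissible s I) (≡₂ᵇ-suc a c) ⟩
  (a ≡₂ᵇ c) ∧ admissible (a ≡₂ᵇ c) I            ∎
  where open ≡-Reasoning

inCalI≡admissible : ∀ {n} (I : Vec Bool n) → inCalI I ≡ admissible true I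
inCalI≡admissible = inCalIFrom≡admissible 0 0

-- Sums over subsets

when : Bool → ℤ → ℤ
when b x = if b then x else + 0

when-zero : ∀ b → when b (+ 0) ≡ + 0
when-zero b = if-eta b

when-* : ∀ b c x → when b (c * x) ≡ c * when b x
when-* false c x = sym (ℤP.*-zeroʳ c)
when-* true  c x = refl

when-+ : ∀ b x y → when b (x + y) ≡ when b x + when b y
when-+ false x y = refl
when-+ true  x y = refl

when-cong : ∀ b {x y} → (T b → x ≡ y) → when b x ≡ when b y
when-cong false x≡y = refl
when-cong true  x≡y = x≡y _

Σℤ : List ℤ → ℤ
Σℤ = List.foldr _+_ (+ 0)

Σℤ-++ : ∀ xs ys → Σℤ (xs ++ ys) ≡ Σℤ xs + Σℤ ys
Σℤ-++ []       ys = sym (ℤP.+-identityˡ (Σℤ ys))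
Σℤ-++ (x ∷ xs) ys = trans (cong (_+_ x) (Σℤ-++ xs ys)) (sym (ℤP.+-assoc x (Σℤ xs) (Σℤ ys)))

Σℤ-map-* : ∀ {A : Set} c (F : A → ℤ) xs → Σℤ (map (λ x → c * F x) xs) ≡ c * Σℤ (map F xs)
Σℤ-map-* c F []       = sym (ℤP.*-zeroʳ c)
Σℤ-map-* c F (x ∷ xs) = trans (cong (_+_ (c * F x)) (Σℤ-map-* c F xs)) (sym (ℤP.*-distribˡ-+ c (F x) _))

Σℤ-map-zero : ∀ {A : Set} (xs : List A) → Σℤ (map (λ _ → + 0) xs) ≡ + 0
Σℤ-map-zero []       = refl
Σℤ-map-zero (x ∷ xs) = trans (ℤP.+-identityˡ _) (Σℤ-map-zero xs)

Σℤ-map-filter : ∀ {A : Set} {P : Pred A 0ℓ} (P? : Decidable P) (F : A → ℤ) xs →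
                Σℤ (map F (filter P? xs)) ≡ Σℤ (map (λ x → when (does (P? x)) (F x)) xs)
Σℤ-map-filter P? F []       = refl
Σℤ-map-filter P? F (x ∷ xs) with does (P? x)
... | false = trans (Σℤ-map-filter P? F xs) (sym (ℤP.+-identityˡ _))
... | true  = cong (_+_ (F x)) (Σℤ-map-filter P? F xs)

Σℤ-allSubsets-suc : ∀ n (F : Vec Bool (suc n) → ℤ) →
  Σℤ (map F (allSubsets (suc n))) ≡ Σℤ (map (F ∘ (false ∷_)) (allSubsets n)) + Σℤ (map (F ∘ (true ∷_)) (allSubsets n))
Σℤ-allSubsets-suc n F = begin
  Σℤ (map F (map (false ∷_) S ++ map (true ∷_) S))           ≡⟨ cong Σℤ (ListP.map-++ F (map (false ∷_) S) _) ⟩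
  Σℤ (map F (map (false ∷_) S) ++ map F (map (true ∷_) S))   ≡⟨ Σℤ-++ (map F (map (false ∷_) S)) _ ⟩
  Σℤ (map F (map (false ∷_) S)) + Σℤ (map F (map (true ∷_) S))
                               ≡⟨ cong₂ _+_ (cong Σℤ (ListP.map-∘ S)) (cong Σℤ (ListP.map-∘ S)) ⟨
  Σℤ (map (F ∘ (false ∷_)) S) + Σℤ (map (F ∘ (true ∷_)) S)   ∎
  where
  open ≡-Reasoning
  S = allSubsets n

admissibleTerm : ∀ {n} → (ℕ → ℤ) → Bool → ℕ → Vec Bool n → ℤ
admissibleTerm m s k I = when (card I ℕ.≡ᵇ k) (when (admissible s I) (prodOver m I))

admissiblePoly : (ℕ → ℤ) → Bool → ℕ → Poly
admissiblePoly m s n k = Σℤ (map (admissibleTerm m s k) (allSubsets n))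

parityPart : ℕ → Poly → Poly
parityPart n p k = when (k ≡₂ᵇ n) (p k)

does-≟-true : ∀ b → does (b Bool.≟ true) ≡ b
does-≟-true false = refl
does-≟-true true  = refl

f≗parityPart : ∀ n m → f n m ≗ parityPart n (admissiblePoly m true n)
f≗parityPart n m k = cong (when (k ≡₂ᵇ n)) (begin
  Σℤ (map (prodOver m) (filter inCalI? (filter card? S)))
    ≡⟨ Σℤ-map-filter inCalI? (prodOver m) (filter card? S) ⟩
  Σℤ (map (λ I → when (does (inCalI? I)) (prodOver m I)) (filter card? S))
    ≡⟨ Σℤ-map-filter card? _ S ⟩
  Σℤ (map (λ I → when (does (card? I)) (when (does (inCalI? I)) (prodOver m I))) S)
    ≡⟨ cong Σℤ (ListP.map-cong summand S) ⟩
  admissiblePoly m true n k ∎)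
  where
  open ≡-Reasoning
  S = allSubsets n
  card? = λ (I : Vec Bool n) → card I ℕ.≟ k
  inCalI? = λ (I : Vec Bool n) → inCalI I Bool.≟ true
  summand : ∀ I → when (does (card? I)) (when (does (inCalI? I)) (prodOver m I)) ≡ admissibleTerm m true k I
  summand I = cong (λ b → when (card I ℕ.≡ᵇ k) (when b (prodOver m I)))
                   (trans (does-≟-true (inCalI I)) (inCalI≡admissible I))

admissibleTerm-false∷ : ∀ {n} m s k (I : Vec Bool n) → admissibleTerm m s k (false ∷ I) ≡ admissibleTerm (m ∘ suc) (not s) k I
admissibleTerm-false∷ m s k I =
  cong₂ (λ c P → when (c ℕ.≡ᵇ k) (when (admissible (not s) I) P)) (card-false∷ I) (prodOver-false∷ m I)

admissibleTerm-false-true∷ : ∀ {n} m k (I : Vec Bool n) → admissibleTerm m false k (true ∷ I) ≡ + 0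
admissibleTerm-false-true∷ m k I = when-zero (card (true ∷ I) ℕ.≡ᵇ k)

admissibleTerm-true-true∷-zero : ∀ {n} m (I : Vec Bool n) → admissibleTerm m true 0 (true ∷ I) ≡ + 0
admissibleTerm-true-true∷-zero m I = cong (λ c → when (c ℕ.≡ᵇ 0) (when (admissible true I) (prodOver m (true ∷ I)))) (card-true∷ I)

admissibleTerm-true-true∷-suc : ∀ {n} m k (I : Vec Bool n) →
  admissibleTerm m true (suc k) (true ∷ I) ≡ m 0 * admissibleTerm (m ∘ suc) true k I
admissibleTerm-true-true∷-suc m k I = begin
  admissibleTerm m true (suc k) (true ∷ I)
    ≡⟨ cong₂ (λ c P → when (c ℕ.≡ᵇ suc k) (when (admissible true I) P)) (card-true∷ I) (prodOver-true∷ m I) ⟩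
  when (card I ℕ.≡ᵇ k) (when (admissible true I) (m 0 * prodOver (m ∘ suc) I))
    ≡⟨ cong (when (card I ℕ.≡ᵇ k)) (when-* (admissible true I) (m 0) _) ⟩
  when (card I ℕ.≡ᵇ k) (m 0 * when (admissible true I) (prodOver (m ∘ suc) I))
    ≡⟨ when-* (card I ℕ.≡ᵇ k) (m 0) _ ⟩
  m 0 * admissibleTerm (m ∘ suc) true k I ∎
  where open ≡-Reasoning

admissiblePoly-false-suc : ∀ m n → admissiblePoly m false (suc n) ≗ admissiblePoly (m ∘ suc) true n
admissiblePoly-false-suc m n k = begin
  admissiblePoly m false (suc n) k
    ≡⟨ Σℤ-allSubsets-suc n (admissibleTerm m false k) ⟩
  Σℤ (map (admissibleTerm m false k ∘ (false ∷_)) S) + Σℤ (map (admissibleTerm m false k ∘ (true ∷_)) S)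
    ≡⟨ cong₂ _+_ (cong Σℤ (ListP.map-cong (admissibleTerm-false∷ m false k) S))
                 (trans (cong Σℤ (ListP.map-cong (admissibleTerm-false-true∷ m k) S)) (Σℤ-map-zero S)) ⟩
  admissiblePoly (m ∘ suc) true n k + + 0
    ≡⟨ ℤP.+-identityʳ _ ⟩
  admissiblePoly (m ∘ suc) true n k ∎
  where
  open ≡-Reasoning
  S = allSubsets n

admissiblePoly-true-suc : ∀ m n →
  admissiblePoly m true (suc n) ≗ (admissiblePoly (m ∘ suc) false n ⊕ m 0 · shift (admissiblePoly (m ∘ suc) true n))
admissiblePoly-true-suc m n k = begin
  admissiblePoly m true (suc n) k
    ≡⟨ Σℤ-allSubsets-suc n (admissibleTerm m true k) ⟩
  Σℤ (map (admissibleTerm m true k ∘ (false ∷_)) S) + Σℤ (map (admissibleTerm m true k ∘ (true ∷_)) S)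
    ≡⟨ cong₂ _+_ (cong Σℤ (ListP.map-cong (admissibleTerm-false∷ m true k) S)) (chosen k) ⟩
  admissiblePoly (m ∘ suc) false n k + m 0 * shift (admissiblePoly (m ∘ suc) true n) k ∎
  where
  open ≡-Reasoning
  S = allSubsets n
  chosen : ∀ k → Σℤ (map (admissibleTerm m true k ∘ (true ∷_)) S) ≡ m 0 * shift (admissiblePoly (m ∘ suc) true n) k
  chosen zero    = trans (cong Σℤ (ListP.map-cong (admissibleTerm-true-true∷-zero m) S))
                         (trans (Σℤ-map-zero S) (sym (ℤP.*-zeroʳ (m 0))))
  chosen (suc k) = trans (cong Σℤ (ListP.map-cong (admissibleTerm-true-true∷-suc m k) S))
                         (Σℤ-map-* (m 0) (admissibleTerm (m ∘ suc) true k) S)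

prodOver-scale : ∀ {n} c m (I : Vec Bool n) → prodOver (λ i → c * m i) I ≡ c ^ card I * prodOver m I
prodOver-scale c m []          = refl
prodOver-scale c m (false ∷ I) = begin
  prodOver (λ i → c * m i) (false ∷ I)      ≡⟨ prodOver-false∷ (λ i → c * m i) I ⟩
  prodOver (λ i → c * m (suc i)) I          ≡⟨ prodOver-scale c (m ∘ suc) I ⟩
  c ^ card I * prodOver (m ∘ suc) I         ≡⟨ cong₂ (λ j P → c ^ j * P) (card-false∷ I) (prodOver-false∷ m I) ⟨
  c ^ card (false ∷ I) * prodOver m (false ∷ I) ∎
  where open ≡-Reasoning
prodOver-scale c m (true ∷ I)  = begin
  prodOver (λ i → c * m i) (true ∷ I)               ≡⟨ prodOver-true∷ (λ i → c * m i) I ⟩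
  c * m 0 * prodOver (λ i → c * m (suc i)) I        ≡⟨ cong (c * m 0 *_) (prodOver-scale c (m ∘ suc) I) ⟩
  c * m 0 * (c ^ card I * prodOver (m ∘ suc) I)     ≡⟨ regroup c (m 0) (c ^ card I) (prodOver (m ∘ suc) I) ⟩
  c * c ^ card I * (m 0 * prodOver (m ∘ suc) I)     ≡⟨ cong₂ (λ j P → c ^ j * P) (card-true∷ I) (prodOver-true∷ m I) ⟨
  c ^ card (true ∷ I) * prodOver m (true ∷ I)       ∎
  where
  open ≡-Reasoning
  regroup : ∀ c a e P → c * a * (e * P) ≡ c * e * (a * P)
  regroup = solve-∀

prodOver-altSign-suc : ∀ {n} (I : Vec Bool n) → prodOver (altSign ∘ suc) I ≡ altSign (card I) * prodOver altSign I
prodOver-altSign-suc I = begin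
  prodOver (altSign ∘ suc) I                ≡⟨ prodOver-cong (λ i → trans (altSign-suc i) (sym (ℤP.-1*i≡-i (altSign i)))) I ⟩
  prodOver (λ i → -1ℤ * altSign i) I        ≡⟨ prodOver-scale -1ℤ altSign I ⟩
  -1ℤ ^ card I * prodOver altSign I         ≡⟨ cong (_* prodOver altSign I) (-1^≡altSign (card I)) ⟩
  altSign (card I) * prodOver altSign I     ∎
  where open ≡-Reasoning

-- The recurrence for g

reflect : Poly → Poly
reflect p k = altSign k * p k

reflect-cong : ∀ {p q} → p ≗ q → reflect p ≗ reflect q
reflect-cong p≗q k = cong (altSign k *_) (p≗q k)

reflect-involutive : ∀ p → reflect (reflect p) ≗ p
reflect-involutive p k = begin
  altSign k * (altSign k * p k)   ≡⟨ ℤP.*-assoc (altSign k) (altSign k) (p k) ⟨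
  altSign k * altSign k * p k     ≡⟨ cong (_* p k) (altSign-square k) ⟩
  1ℤ * p k                        ≡⟨ ℤP.*-identityˡ (p k) ⟩
  p k                             ∎
  where open ≡-Reasoning

admissiblePoly-altSign-suc : ∀ s n → admissiblePoly (altSign ∘ suc) s n ≗ reflect (admissiblePoly altSign s n)
admissiblePoly-altSign-suc s n k =
  trans (cong Σℤ (ListP.map-cong term (allSubsets n))) (Σℤ-map-* (altSign k) (admissibleTerm altSign s k) (allSubsets n))
  where
  open ≡-Reasoning
  term : ∀ I → admissibleTerm (altSign ∘ suc) s k I ≡ altSign k * admissibleTerm altSign s k I
  term I = begin
    when (card I ℕ.≡ᵇ k) (when (admissible s I) (prodOver (altSign ∘ suc) I))
      ≡⟨ when-cong (card I ℕ.≡ᵇ k) (λ |I|≡k → cong (when (admissible s I))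
           (trans (prodOver-altSign-suc I) (cong (λ j → altSign j * prodOver altSign I) (ℕP.≡ᵇ⇒≡ (card I) k |I|≡k)))) ⟩
    when (card I ℕ.≡ᵇ k) (when (admissible s I) (altSign k * prodOver altSign I))
      ≡⟨ cong (when (card I ℕ.≡ᵇ k)) (when-* (admissible s I) (altSign k) _) ⟩
    when (card I ℕ.≡ᵇ k) (altSign k * when (admissible s I) (prodOver altSign I))
      ≡⟨ when-* (card I ℕ.≡ᵇ k) (altSign k) _ ⟩
    altSign k * admissibleTerm altSign s k I ∎

admissiblePoly-altSign-false-suc : ∀ n → admissiblePoly altSign false (suc n) ≗ reflect (admissiblePoly altSign true n)
admissiblePoly-altSign-false-suc n = begin
  admissiblePoly altSign false (suc n)       ≈⟨ admissiblePoly-false-suc altSign n ⟩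
  admissiblePoly (altSign ∘ suc) true n      ≈⟨ admissiblePoly-altSign-suc true n ⟩
  reflect (admissiblePoly altSign true n)    ∎
  where open ≗-Reasoning

admissiblePoly-altSign-rec : ∀ n → admissiblePoly altSign true (suc (suc n)) ≗
  (admissiblePoly altSign true n ⊕ shift (reflect (admissiblePoly altSign true (suc n))))
admissiblePoly-altSign-rec n = begin
  h (suc (suc n))
    ≈⟨ admissiblePoly-true-suc altSign (suc n) ⟩
  admissiblePoly (altSign ∘ suc) false (suc n) ⊕ 1ℤ · shift (admissiblePoly (altSign ∘ suc) true (suc n))
    ≈⟨ ⊕-cong (admissiblePoly-altSign-suc false (suc n)) (λ k → ℤP.*-identityˡ _) ⟩
  reflect (admissiblePoly altSign false (suc n)) ⊕ shift (admissiblePoly (altSign ∘ suc) true (suc n))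
    ≈⟨ ⊕-cong (reflect-cong (admissiblePoly-altSign-false-suc n)) (shift-cong (admissiblePoly-altSign-suc true (suc n))) ⟩
  reflect (reflect (h n)) ⊕ shift (reflect (h (suc n)))
    ≈⟨ ⊕-congʳ (shift (reflect (h (suc n)))) (reflect-involutive (h n)) ⟩
  h n ⊕ shift (reflect (h (suc n)))  ∎
  where
  open ≗-Reasoning
  h = admissiblePoly altSign true

parityPart-cong : ∀ n {p q} → p ≗ q → parityPart n p ≗ parityPart n q
parityPart-cong n p≗q k = cong (when (k ≡₂ᵇ n)) (p≗q k)

parityPart-⊕ : ∀ n p q → parityPart n (p ⊕ q) ≗ (parityPart n p ⊕ parityPart n q)
parityPart-⊕ n p q k = when-+ (k ≡₂ᵇ n) (p k) (q k)

parityPart-ss : ∀ n p → parityPart (suc (suc n)) p ≗ parityPart n p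
parityPart-ss n p k = cong (λ b → when b (p k)) (≡₂ᵇ-ssʳ k n)

parityPart-shift : ∀ n p → parityPart (suc n) (shift p) ≗ shift (parityPart n p)
parityPart-shift n p zero    = when-zero (0 ≡₂ᵇ suc n)
parityPart-shift n p (suc k) = cong (λ b → when b (p k)) (≡₂ᵇ-suc k n)

parityPart-reflect : ∀ n p → parityPart n (reflect p) ≗ altSign n · parityPart n p
parityPart-reflect n p k =
  trans (when-cong (k ≡₂ᵇ n) (λ k≡₂n → cong (_* p k) (≡₂ᵇ⇒altSign≡ k n k≡₂n))) (when-* (k ≡₂ᵇ n) (altSign n) (p k))

g≗parityPart : ∀ n → g n ≗ parityPart n (admissiblePoly altSign true n)
g≗parityPart n = f≗parityPart n altSign

g-rec : ∀ n → g (suc (suc n)) ≗ (g n ⊕ altSign (suc n) · shift (g (suc n)))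
g-rec n = begin
  g (suc (suc n))
    ≈⟨ g≗parityPart (suc (suc n)) ⟩
  parityPart (suc (suc n)) (h (suc (suc n)))
    ≈⟨ parityPart-cong (suc (suc n)) (admissiblePoly-altSign-rec n) ⟩
  parityPart (suc (suc n)) (h n ⊕ shift (reflect (h (suc n))))
    ≈⟨ parityPart-⊕ (suc (suc n)) (h n) _ ⟩
  parityPart (suc (suc n)) (h n) ⊕ parityPart (suc (suc n)) (shift (reflect (h (suc n))))
    ≈⟨ ⊕-cong (parityPart-ss n (h n)) (parityPart-shift (suc n) _) ⟩
  parityPart n (h n) ⊕ shift (parityPart (suc n) (reflect (h (suc n))))
    ≈⟨ ⊕-congˡ (parityPart n (h n)) (shift-cong (parityPart-reflect (suc n) (h (suc n)))) ⟩
  parityPart n (h n) ⊕ shift (altSign (suc n) · parityPart (suc n) (h (suc n)))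
    ≈⟨ ⊕-cong (g≗parityPart n) (shift-cong (·-congˡ (altSign (suc n)) (g≗parityPart (suc n)))) ⟨
  g n ⊕ shift (altSign (suc n) · g (suc n))
    ≈⟨ ⊕-congˡ (g n) (·-shift (altSign (suc n)) (g (suc n))) ⟨
  g n ⊕ altSign (suc n) · shift (g (suc n))  ∎
  where
  open ≗-Reasoning
  h = admissiblePoly altSign true

g-zero : g 0 ≗ one
g-zero zero    = refl
g-zero (suc k) = if-eta _

g-one : g 1 ≗ shift one
g-one zero          = refl
g-one (suc zero)    = refl
g-one (suc (suc k)) = if-eta _

mainTheorem6 : (n : ℕ) → (k : ℕ) →
    ((g (suc n) ⊗ g (suc n)) ⊕ (g (suc (suc n)) ⊗ g n)) k ≡ one k
mainTheorem6 = cassini refl g-zero g-one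
  where open ThreeTermRecurrence g (altSign ∘ suc) (altSign-suc ∘ suc) g-rec
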